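{- Let $F$ be a CNF formula, $(T,\delta)$ a decomposition tree of $I(F)$, and let $x,y,z$ be nodes of $T$ such that $x$ and $y$ are the children of $z$. Let $s$ be a proper shape for $z$. Suppose $s_x$ (a shape for $x$) and $s_y$ (a shape for $y$) generate $s$ and both $N_x(s_x)$ and $N_y(s_y)$ are nonempty. Then $s_x$ and $s_y$ are proper.
   Context: A clause is a finite set of literals (variables $x$ or negations $\bar x$) not containing both $x$ and $\bar x$; a CNF formula $F$ is a finite set of clauses; $\mathrm{var}(C)$, $\mathrm{var}(F)$ denote occurring variables. The incidence graph $I(F)$ has vertex set $\mathrm{var}(F)\cup F$ and edges $Cx$ for $x\in\mathrm{var}(C)$. A decomposition tree of a graph is a pair $(T,\delta)$ with $T$ a rooted binary tree and $\delta$ a bijection from the leaves of $T$ to the vertex set. For a set of variables $X$, $2^X$ is the set of maps $\sigma:X\to\{0,1\}$ ($\sigma(\bar x)=1-\sigma(x)$); $\sigma$ satisfies clause $C$ if $\sigma(\ell)=1$ for some $\ell\in C$ with variable in $X$. For a set of clauses $G$, $G(\sigma)$ is the set of clauses of $G$ satisfied by $\sigma$, and $\mathrm{Proj}(G,X)=\{G(\sigma):\sigma\in2^X\}$. For a node $z$ of $T$ let $T_z$ be the subtree rooted at $z$ with leaf set $L(T_z)$; $\mathrm{var}_z=\mathrm{var}(F)\cap\delta(L(T_z))$, $F_z=F\cap\delta(L(T_z))$, $\overline{F_z}=F\setminus F_z$, $\overline{\mathrm{var}_z}=\mathrm{var}(F)\setminus\mathrm{var}_z$. A shape for $z$ is a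 pair $(\mathit{out},\mathit{in})$ with $\mathit{out}\subseteq\overline{F_z}$, $\mathit{in}\subseteq F_z$. An assignment $\tau\in2^{\mathrm{var}_z}$ is of shape $(\mathit{out},\mathit{in})$ if (i) $\overline{F_z}(\tau)=\mathit{out}$ and (ii) every clause $C\in F_z$ is satisfied by $\tau$ or belongs to $\mathit{in}$. $N_z(s)$ is the set of assignments in $2^{\mathrm{var}_z}$ of shape $s$. The shape is proper if $\mathit{out}\in\mathrm{Proj}(\overline{F_z},\mathrm{var}_z)$ and $\mathit{in}\in\mathrm{Proj}(F_z,\overline{\mathrm{var}_z})$. If $x,y$ are the children of $z$, shapes $(\mathit{out}_x,\mathit{in}_x)$ for $x$ and $(\mathit{out}_y,\mathit{in}_y)$ for $y$ generate the shape $(\mathit{out}_z,\mathit{in}_z)$ for $z$ if (1) $\mathit{out}_z=(\mathit{out}_x\cup\mathit{out}_y)\cap\overline{F_z}$, (2) $\mathit{in}_x=(\mathit{in}_z\cup\mathit{out}_y)\cap F_x$, and (3) $\mathit{in}_y=(\mathit{in}_z\cup\mathit{out}_x)\cap F_y$. -}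

module Defs where

open import Data.Nat using (ℕ)
open import Data.Bool using (Bool; true; false; _∧_; _∨_; not; if_then_else_)
open import Data.Fin using (Fin)
open import Data.Fin.Properties using (_≟_)
open import Data.Fin.Subset using (Subset; _∈_; _⊆_; ∁; _∩_; _∪_)
open import Data.Maybe using (Maybe; just; nothing)
open import Data.Sum using (_⊎_; inj₁; inj₂)
open import Data.Product using (_×_; _,_; Σ; ∃; proj₁; proj₂)
open import Data.List using (List; []; _∷_; _++_; allFin)
open import Data.Bool.ListAction using (any)
open import Data.List.Membership.Propositional using () renaming (_∈_ to _∈ₗ_)
open import Data.List.Relation.Unary.Unique.Propositional using (Unique)
open import Data.Vec using (tabulate; lookup)
open import Relation.Nullary using (¬_; Dec; yes; no)
open import Relation.Binary.PropositionalEquality using (_≡_; _≢_)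

-- Variables are Fin n. A clause over Fin n assigns to each variable
-- nothing (variable absent), just true (literal x) or just false (literal x̄).
-- This encoding forbids containing both x and x̄.
Clause : ℕ → Set
Clause n = Fin n → Maybe Bool

record CNF (n m : ℕ) : Set where
  field
    clause   : Fin m → Clause n
    distinct : ∀ j k → (∀ i → clause j i ≡ clause k i) → j ≡ k
    -- var(F) = Fin n : every variable occurs in some clause
    occurs   : ∀ i → ∃ λ j → clause j i ≢ nothing
open CNF public

Vertex : ℕ → ℕ → Set
Vertex n m = Fin n ⊎ Fin m

data Tree (V : Set) : Set where
  leaf : V → Tree V
  node : Tree V → Tree V → Tree V

leaves : ∀ {V} → Tree V → List V
leaves (leaf v)   = v ∷ []
leaves (node l r) = leaves l ++ leaves r

-- s ≼ t : s is the subtree T_z rooted at some node z of t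
data _≼_ {V : Set} (s : Tree V) : Tree V → Set where
  here : s ≼ s
  inl  : ∀ {l r} → s ≼ l → s ≼ node l r
  inr  : ∀ {l r} → s ≼ r → s ≼ node l r

-- (T , δ) is a decomposition tree of I(F): δ is a bijection from leaves
-- to the vertex set var(F) ∪ F.
IsDecompositionTree : ∀ {n m} → Tree (Vertex n m) → Set
IsDecompositionTree {n} {m} T =
  Unique (leaves T) × (∀ (v : Vertex n m) → v ∈ₗ leaves T)

eqV : ∀ {n m} → Vertex n m → Vertex n m → Bool
eqV (inj₁ a) (inj₁ b) with a ≟ b
... | yes _ = true
... | no _  = false
eqV (inj₂ a) (inj₂ b) with a ≟ b
... | yes _ = true
... | no _  = false
eqV _ _ = false

elemV : ∀ {n m} → Vertex n m → List (Vertex n m) → Bool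
elemV v []       = false
elemV v (w ∷ ws) = eqV v w ∨ elemV v ws

varOf : ∀ {n m} → Tree (Vertex n m) → Subset n
varOf t = tabulate λ i → elemV (inj₁ i) (leaves t)

clsOf : ∀ {n m} → Tree (Vertex n m) → Subset m
clsOf t = tabulate λ j → elemV (inj₂ j) (leaves t)

-- Assignments σ ∈ 2^X are represented by total maps Fin n → Bool of which
-- only the values on X matter.
Assignment : ℕ → Set
Assignment n = Fin n → Bool

litSat : ∀ {n} → Subset n → Assignment n → Clause n → Fin n → Bool
litSat X σ C i with C i
... | nothing = false
... | just b  = lookup X i ∧ (if b then σ i else not (σ i))

satB : ∀ {n} → Subset n → Assignment n → Clause n → Bool
satB {n} X σ C = any (litSat X σ C) (allFin n)

satisfied : ∀ {n m} → CNF n m → Subset m → Subset n → Assignment n → Subset m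
satisfied F G X σ = tabulate λ j → lookup G j ∧ satB X σ (clause F j)

InProj : ∀ {n m} → CNF n m → Subset m → Subset n → Subset m → Set
InProj {n} F G X A = Σ (Assignment n) λ σ → satisfied F G X σ ≡ A

record Shape (m : ℕ) : Set where
  constructor ⟨_,_⟩
  field
    out : Subset m
    inn : Subset m
open Shape public

IsShapeFor : ∀ {n m} → Tree (Vertex n m) → Shape m → Set
IsShapeFor t s = (out s ⊆ ∁ (clsOf t)) × (inn s ⊆ clsOf t)

OfShape : ∀ {n m} → CNF n m → Tree (Vertex n m) → Shape m → Assignment n → Set
OfShape F t s τ =
  (satisfied F (∁ (clsOf t)) (varOf t) τ ≡ out s) ×
  (∀ j → j ∈ clsOf t → satB (varOf t) τ (clause F j) ≡ true ⊎ j ∈ inn s)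

NNonempty : ∀ {n m} → CNF n m → Tree (Vertex n m) → Shape m → Set
NNonempty {n} F t s = Σ (Assignment n) λ τ → OfShape F t s τ

Proper : ∀ {n m} → CNF n m → Tree (Vertex n m) → Shape m → Set
Proper F t s =
  InProj F (∁ (clsOf t)) (varOf t) (out s) ×
  InProj F (clsOf t) (∁ (varOf t)) (inn s)

Generate : ∀ {n m} → Tree (Vertex n m) → Tree (Vertex n m) →
           Shape m → Shape m → Shape m → Set
Generate tx ty sx sy sz =
  (out sz ≡ (out sx ∪ out sy) ∩ ∁ (clsOf (node tx ty))) ×
  (inn sx ≡ (inn sz ∪ out sy) ∩ clsOf tx) ×
  (inn sy ≡ (inn sz ∪ out sx) ∩ clsOf ty)

-- The out-component of s_x is the projection of the assignment τ_x ∈ N_x(s_x) itself.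
-- For the in-component, take σ on the complement of var_z realising in_z ∈ Proj(F_z, ∁var_z)
-- and overwrite it on var_y by some τ_y ∈ N_y(s_y).  Since ∁var_x is the disjoint union of
-- ∁var_z and var_y, a clause of F_x is satisfied by the glued assignment exactly when σ satisfies
-- it (it lies in in_z) or τ_y does (it lies in out_y), so it realises (in_z ∪ out_y) ∩ F_x = in_x.
module Submission where

open import Defs
open import Algebra.Bundles using (CommutativeMonoid)
import Algebra.Lattice.Properties.BooleanAlgebra as BooleanAlgebraProperties
import Algebra.Properties.CommutativeSemigroup as CommutativeSemigroupProperties
open import Data.Bool using (Bool; true; false; _∧_; _∨_; not; if_then_else_)
open import Data.Bool.ListAction using (any; or)
open import Data.Bool.Properties
  using (∨-assoc; ∨-identityʳ; ∧-distribˡ-∨; ∨-commutativeMonoid; ∧-commutativeMonoid)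
open import Data.Empty using (⊥-elim)
open import Data.Fin using (Fin)
open import Data.Fin.Properties using (_≟_)
open import Data.Fin.Subset using (Subset; ⊥; ⊤; ∁; _∩_; _∪_)
open import Data.Fin.Subset.Properties
  using ( ∩-comm; ∩-identityˡ; ∪-comm; ∪-identityʳ; ∪-inverseˡ; ∩-distribʳ-∪; ∩-abs-∪
        ; ∪-∩-booleanAlgebra)
open import Data.List using (List; []; _∷_; _++_; allFin)
open import Data.List.Properties using (map-cong)
open import Data.List.Membership.Propositional using (_∈_; _∉_)
open import Data.List.Membership.Propositional.Properties using (∈-++⁺ʳ)
import Data.List.Relation.Unary.All as All
import Data.List.Relation.Unary.All.Properties as All
open import Data.List.Relation.Unary.AllPairs using ([]; _∷_)
open import Data.List.Relation.Unary.Any using (here; there)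
open import Data.List.Relation.Unary.Unique.Propositional using (Unique)
open import Data.Maybe using (just; nothing)
open import Data.Nat using (ℕ)
open import Data.Product using (_×_; _,_)
open import Data.Sum using (inj₁; inj₂)
open import Data.Vec using (Vec; tabulate; lookup)
open import Data.Vec.Properties
  using (lookup∘tabulate; tabulate∘lookup; tabulate-cong; lookup-map; lookup-zipWith; lookup-replicate)
open import Relation.Nullary using (yes; no)
open import Relation.Binary.PropositionalEquality
open ≡-Reasoning

open CommutativeSemigroupProperties (CommutativeMonoid.commutativeSemigroup ∨-commutativeMonoid)
  using () renaming (interchange to ∨-interchange)
open CommutativeSemigroupProperties (CommutativeMonoid.commutativeSemigroup ∧-commutativeMonoid)
  using () renaming (xy∙z≈xz∙y to ∧-swapʳ)

lookup-ext : ∀ {A : Set} {k} {u v : Vec A k} → (∀ i → lookup u i ≡ lookup v i) → u ≡ v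
lookup-ext {u = u} {v} eq = begin
  u                   ≡⟨ tabulate∘lookup u ⟨
  tabulate (lookup u) ≡⟨ tabulate-cong eq ⟩
  tabulate (lookup v) ≡⟨ tabulate∘lookup v ⟩
  v                   ∎

module _ {k : ℕ} where

  lookup-∪ : ∀ (p q : Subset k) i → lookup (p ∪ q) i ≡ lookup p i ∨ lookup q i
  lookup-∪ p q i = lookup-zipWith _∨_ i p q

  lookup-∩ : ∀ (p q : Subset k) i → lookup (p ∩ q) i ≡ lookup p i ∧ lookup q i
  lookup-∩ p q i = lookup-zipWith _∧_ i p q

  lookup-∁ : ∀ (p : Subset k) i → lookup (∁ p) i ≡ not (lookup p i)
  lookup-∁ p i = lookup-map i not p

  lookup-⊥ : ∀ i → lookup (⊥ {k}) i ≡ false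
  lookup-⊥ i = lookup-replicate i false

  p∩q≡⊥⇒∁p∩q≡q : ∀ {p q : Subset k} → p ∩ q ≡ ⊥ → ∁ p ∩ q ≡ q
  p∩q≡⊥⇒∁p∩q≡q {p} {q} p∩q≡⊥ = begin
    ∁ p ∩ q             ≡⟨ ∪-identityʳ (∁ p ∩ q) ⟨
    ∁ p ∩ q ∪ ⊥         ≡⟨ cong (∁ p ∩ q ∪_) p∩q≡⊥ ⟨
    ∁ p ∩ q ∪ p ∩ q     ≡⟨ ∩-distribʳ-∪ q (∁ p) p ⟨
    (∁ p ∪ p) ∩ q       ≡⟨ cong (_∩ q) (∪-inverseˡ p) ⟩
    ⊤ ∩ q               ≡⟨ ∩-identityˡ q ⟩
    q                   ∎

  ∁-∪ : ∀ (p q : Subset k) → ∁ (p ∪ q) ≡ ∁ p ∩ ∁ q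
  ∁-∪ = BooleanAlgebraProperties.deMorgan₂ (∪-∩-booleanAlgebra k)

any-∨ : ∀ {A : Set} (f g : A → Bool) xs → any (λ a → f a ∨ g a) xs ≡ any f xs ∨ any g xs
any-∨ f g []       = refl
any-∨ f g (x ∷ xs) = begin
  (f x ∨ g x) ∨ any (λ a → f a ∨ g a) xs ≡⟨ cong ((f x ∨ g x) ∨_) (any-∨ f g xs) ⟩
  (f x ∨ g x) ∨ (any f xs ∨ any g xs)    ≡⟨ ∨-interchange (f x) (g x) (any f xs) (any g xs) ⟩
  (f x ∨ any f xs) ∨ (g x ∨ any g xs)    ∎

overwrite : ∀ {n} → Subset n → Assignment n → Assignment n → Assignment n
overwrite Y τ σ i = if lookup Y i then τ i else σ i

module _ {n : ℕ} (X Y : Subset n) (σ τ : Assignment n) where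

  litSat-overwrite : ∀ C i →
    litSat X (overwrite Y τ σ) C i ≡ litSat (X ∩ ∁ Y) σ C i ∨ litSat (X ∩ Y) τ C i
  litSat-overwrite C i with C i
  ... | nothing = refl
  ... | just b
    rewrite lookup-∩ X (∁ Y) i | lookup-∁ Y i | lookup-∩ X Y i
    with lookup X i | lookup Y i
  ... | false | _     = refl
  ... | true  | true  = refl
  ... | true  | false = sym (∨-identityʳ _)

  satB-overwrite : ∀ C → satB X (overwrite Y τ σ) C ≡ satB (X ∩ ∁ Y) σ C ∨ satB (X ∩ Y) τ C
  satB-overwrite C = trans (cong or (map-cong (litSat-overwrite C) (allFin n))) (any-∨ _ _ (allFin n))

module _ {n m : ℕ} (F : CNF n m) where

  satisfied-overwrite : ∀ G X Y (σ τ : Assignment n) →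
    satisfied F G X (overwrite Y τ σ) ≡ satisfied F G (X ∩ ∁ Y) σ ∪ satisfied F G (X ∩ Y) τ
  satisfied-overwrite G X Y σ τ = lookup-ext λ j → begin
    lookup (satisfied F G X (overwrite Y τ σ)) j
      ≡⟨ lookup∘tabulate _ j ⟩
    lookup G j ∧ satB X (overwrite Y τ σ) (clause F j)
      ≡⟨ cong (lookup G j ∧_) (satB-overwrite X Y σ τ (clause F j)) ⟩
    lookup G j ∧ (satB (X ∩ ∁ Y) σ (clause F j) ∨ satB (X ∩ Y) τ (clause F j))
      ≡⟨ ∧-distribˡ-∨ (lookup G j) _ _ ⟩
    (lookup G j ∧ satB (X ∩ ∁ Y) σ (clause F j)) ∨ (lookup G j ∧ satB (X ∩ Y) τ (clause F j))
      ≡⟨ cong₂ _∨_ (lookup∘tabulate _ j) (lookup∘tabulate _ j) ⟨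
    lookup (satisfied F G (X ∩ ∁ Y) σ) j ∨ lookup (satisfied F G (X ∩ Y) τ) j
      ≡⟨ lookup-∪ (satisfied F G (X ∩ ∁ Y) σ) (satisfied F G (X ∩ Y) τ) j ⟨
    lookup (satisfied F G (X ∩ ∁ Y) σ ∪ satisfied F G (X ∩ Y) τ) j
      ∎

  satisfied-∩ : ∀ G H X (σ : Assignment n) → satisfied F G X σ ∩ H ≡ satisfied F (G ∩ H) X σ
  satisfied-∩ G H X σ = lookup-ext λ j → begin
    lookup (satisfied F G X σ ∩ H) j
      ≡⟨ lookup-∩ (satisfied F G X σ) H j ⟩
    lookup (satisfied F G X σ) j ∧ lookup H j
      ≡⟨ cong (_∧ lookup H j) (lookup∘tabulate _ j) ⟩
    (lookup G j ∧ satB X σ (clause F j)) ∧ lookup H j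
      ≡⟨ ∧-swapʳ (lookup G j) _ _ ⟩
    (lookup G j ∧ lookup H j) ∧ satB X σ (clause F j)
      ≡⟨ cong (_∧ satB X σ (clause F j)) (lookup-∩ G H j) ⟨
    lookup (G ∩ H) j ∧ satB X σ (clause F j)
      ≡⟨ lookup∘tabulate _ j ⟨
    lookup (satisfied F (G ∩ H) X σ) j
      ∎

  inProj-child : ∀ {Vx Vy Vz : Subset n} {Fx Fy Fz A : Subset m} (τ : Assignment n) →
    Vz ≡ Vx ∪ Vy → Fz ≡ Fx ∪ Fy → Vx ∩ Vy ≡ ⊥ → Fx ∩ Fy ≡ ⊥ →
    InProj F Fz (∁ Vz) A →
    InProj F Fx (∁ Vx) ((A ∪ satisfied F (∁ Fy) Vy τ) ∩ Fx)
  inProj-child {Vx} {Vy} {_} {Fx} {Fy} τ refl refl Vx∩Vy≡⊥ Fx∩Fy≡⊥ (σ , refl) =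
    overwrite Vy τ σ , (begin
    satisfied F Fx (∁ Vx) (overwrite Vy τ σ)
      ≡⟨ satisfied-overwrite Fx (∁ Vx) Vy σ τ ⟩
    satisfied F Fx (∁ Vx ∩ ∁ Vy) σ ∪ satisfied F Fx (∁ Vx ∩ Vy) τ
      ≡⟨ cong₂ (λ X Y → satisfied F Fx X σ ∪ satisfied F Fx Y τ)
               (sym (∁-∪ Vx Vy)) (p∩q≡⊥⇒∁p∩q≡q Vx∩Vy≡⊥) ⟩
    satisfied F Fx (∁ (Vx ∪ Vy)) σ ∪ satisfied F Fx Vy τ
      ≡⟨ cong₂ (λ G H → satisfied F G (∁ (Vx ∪ Vy)) σ ∪ satisfied F H Vy τ)
               [Fx∪Fy]∩Fx≡Fx ∁Fy∩Fx≡Fx ⟨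
    satisfied F ((Fx ∪ Fy) ∩ Fx) (∁ (Vx ∪ Vy)) σ ∪ satisfied F (∁ Fy ∩ Fx) Vy τ
      ≡⟨ cong₂ _∪_ (satisfied-∩ (Fx ∪ Fy) Fx (∁ (Vx ∪ Vy)) σ)
                   (satisfied-∩ (∁ Fy) Fx Vy τ) ⟨
    satisfied F (Fx ∪ Fy) (∁ (Vx ∪ Vy)) σ ∩ Fx ∪ satisfied F (∁ Fy) Vy τ ∩ Fx
      ≡⟨ ∩-distribʳ-∪ Fx _ _ ⟨
    (satisfied F (Fx ∪ Fy) (∁ (Vx ∪ Vy)) σ ∪ satisfied F (∁ Fy) Vy τ) ∩ Fx
      ∎)
    where
    [Fx∪Fy]∩Fx≡Fx : (Fx ∪ Fy) ∩ Fx ≡ Fx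
    [Fx∪Fy]∩Fx≡Fx = trans (∩-comm (Fx ∪ Fy) Fx) (∩-abs-∪ Fx Fy)
    ∁Fy∩Fx≡Fx : ∁ Fy ∩ Fx ≡ Fx
    ∁Fy∩Fx≡Fx = p∩q≡⊥⇒∁p∩q≡q (trans (∩-comm Fy Fx) Fx∩Fy≡⊥)

Unique-++⁻ˡ : ∀ {A : Set} (xs : List A) {ys} → Unique (xs ++ ys) → Unique xs
Unique-++⁻ˡ []       _          = []
Unique-++⁻ˡ (x ∷ xs) (x∉ ∷ xs!) = All.++⁻ˡ xs x∉ ∷ Unique-++⁻ˡ xs xs!

Unique-++⁻ʳ : ∀ {A : Set} (xs : List A) {ys} → Unique (xs ++ ys) → Unique ys
Unique-++⁻ʳ []       ys!       = ys!
Unique-++⁻ʳ (x ∷ xs) (_ ∷ xs!) = Unique-++⁻ʳ xs xs!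

Unique-++⇒∉ : ∀ {A : Set} {xs ys : List A} {v} → Unique (xs ++ ys) → v ∈ xs → v ∉ ys
Unique-++⇒∉ {xs = _ ∷ xs} (x∉ ∷ _)  (here refl)  v∈ys = All.lookup x∉ (∈-++⁺ʳ xs v∈ys) refl
Unique-++⇒∉               (_ ∷ xs!) (there v∈xs) v∈ys = Unique-++⇒∉ xs! v∈xs v∈ys

Unique-≼ : ∀ {V : Set} {s t : Tree V} → s ≼ t → Unique (leaves t) → Unique (leaves s)
Unique-≼ here            t! = t!
Unique-≼ (inl {l} s≼l) t! = Unique-≼ s≼l (Unique-++⁻ˡ (leaves l) t!)
Unique-≼ (inr {l} s≼r) t! = Unique-≼ s≼r (Unique-++⁻ʳ (leaves l) t!)

module _ {n m : ℕ} where

  eqV-sound : ∀ (v w : Vertex n m) → eqV v w ≡ true → v ≡ w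
  eqV-sound (inj₁ a) (inj₁ b) eq with a ≟ b
  eqV-sound (inj₁ a) (inj₁ b) eq  | yes refl = refl
  eqV-sound (inj₁ a) (inj₁ b) ()  | no _
  eqV-sound (inj₂ a) (inj₂ b) eq with a ≟ b
  eqV-sound (inj₂ a) (inj₂ b) eq  | yes refl = refl
  eqV-sound (inj₂ a) (inj₂ b) ()  | no _

  elemV-sound : ∀ (v : Vertex n m) vs → elemV v vs ≡ true → v ∈ vs
  elemV-sound v (w ∷ ws) eq with eqV v w in v≟w
  ... | true  = here (eqV-sound v w v≟w)
  ... | false = there (elemV-sound v ws eq)

  elemV-++ : ∀ (v : Vertex n m) xs ys → elemV v (xs ++ ys) ≡ elemV v xs ∨ elemV v ys
  elemV-++ v []       ys = refl
  elemV-++ v (w ∷ ws) ys = trans (cong (eqV v w ∨_) (elemV-++ v ws ys)) (sym (∨-assoc (eqV v w) _ _))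

  elemV-disjoint : ∀ (v : Vertex n m) xs ys → Unique (xs ++ ys) → elemV v xs ∧ elemV v ys ≡ false
  elemV-disjoint v xs ys xs++ys! with elemV v xs in v∈xs | elemV v ys in v∈ys
  ... | false | _     = refl
  ... | true  | false = refl
  ... | true  | true  = ⊥-elim (Unique-++⇒∉ xs++ys! (elemV-sound v xs v∈xs) (elemV-sound v ys v∈ys))

  -- varOf t and clsOf t are definitionally occurring inj₁ (leaves t) and occurring inj₂ (leaves t).
  occurring : ∀ {k} → (Fin k → Vertex n m) → List (Vertex n m) → Subset k
  occurring f vs = tabulate λ i → elemV (f i) vs

  occurring-++ : ∀ {k} (f : Fin k → Vertex n m) xs ys →
    occurring f (xs ++ ys) ≡ occurring f xs ∪ occurring f ys
  occurring-++ f xs ys = lookup-ext λ i → begin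
    lookup (occurring f (xs ++ ys)) i
      ≡⟨ lookup∘tabulate _ i ⟩
    elemV (f i) (xs ++ ys)
      ≡⟨ elemV-++ (f i) xs ys ⟩
    elemV (f i) xs ∨ elemV (f i) ys
      ≡⟨ cong₂ _∨_ (lookup∘tabulate _ i) (lookup∘tabulate _ i) ⟨
    lookup (occurring f xs) i ∨ lookup (occurring f ys) i
      ≡⟨ lookup-∪ (occurring f xs) (occurring f ys) i ⟨
    lookup (occurring f xs ∪ occurring f ys) i
      ∎

  occurring-disjoint : ∀ {k} (f : Fin k → Vertex n m) xs ys → Unique (xs ++ ys) →
    occurring f xs ∩ occurring f ys ≡ ⊥
  occurring-disjoint f xs ys xs++ys! = lookup-ext λ i → begin
    lookup (occurring f xs ∩ occurring f ys) i
      ≡⟨ lookup-∩ (occurring f xs) (occurring f ys) i ⟩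
    lookup (occurring f xs) i ∧ lookup (occurring f ys) i
      ≡⟨ cong₂ _∧_ (lookup∘tabulate _ i) (lookup∘tabulate _ i) ⟩
    elemV (f i) xs ∧ elemV (f i) ys
      ≡⟨ elemV-disjoint (f i) xs ys xs++ys! ⟩
    false
      ≡⟨ lookup-⊥ i ⟨
    lookup ⊥ i
      ∎

module _ {n m : ℕ} (F : CNF n m) {l r : Tree (Vertex n m)} (lr! : Unique (leaves (node l r))) where

  private
    varOf-node : varOf (node l r) ≡ varOf l ∪ varOf r
    varOf-node = occurring-++ inj₁ (leaves l) (leaves r)

    clsOf-node : clsOf (node l r) ≡ clsOf l ∪ clsOf r
    clsOf-node = occurring-++ inj₂ (leaves l) (leaves r)

    varOf-disjoint : varOf l ∩ varOf r ≡ ⊥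
    varOf-disjoint = occurring-disjoint inj₁ (leaves l) (leaves r) lr!

    clsOf-disjoint : clsOf l ∩ clsOf r ≡ ⊥
    clsOf-disjoint = occurring-disjoint inj₂ (leaves l) (leaves r) lr!

  inProj-innˡ : ∀ {A B C} (τ : Assignment n) →
    InProj F (clsOf (node l r)) (∁ (varOf (node l r))) A →
    satisfied F (∁ (clsOf r)) (varOf r) τ ≡ B → C ≡ (A ∪ B) ∩ clsOf l →
    InProj F (clsOf l) (∁ (varOf l)) C
  inProj-innˡ τ A∈Proj refl refl =
    inProj-child F τ varOf-node clsOf-node varOf-disjoint clsOf-disjoint A∈Proj

  inProj-innʳ : ∀ {A B C} (τ : Assignment n) →
    InProj F (clsOf (node l r)) (∁ (varOf (node l r))) A →
    satisfied F (∁ (clsOf l)) (varOf l) τ ≡ B → C ≡ (A ∪ B) ∩ clsOf r →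
    InProj F (clsOf r) (∁ (varOf r)) C
  inProj-innʳ τ A∈Proj refl refl =
    inProj-child F τ
      (trans varOf-node (∪-comm (varOf l) (varOf r)))
      (trans clsOf-node (∪-comm (clsOf l) (clsOf r)))
      (trans (∩-comm (varOf r) (varOf l)) varOf-disjoint)
      (trans (∩-comm (clsOf r) (clsOf l)) clsOf-disjoint)
      A∈Proj

corollary2 : ∀ {n m} (F : CNF n m) (T tx ty : Tree (Vertex n m))
    → IsDecompositionTree T
    → node tx ty ≼ T
    → (s sx sy : Shape m)
    → IsShapeFor (node tx ty) s → Proper F (node tx ty) s
    → IsShapeFor tx sx → IsShapeFor ty sy
    → Generate tx ty sx sy s
    → NNonempty F tx sx → NNonempty F ty sy
    → Proper F tx sx × Proper F ty sy
corollary2 F T tx ty (T! , _) z≼T s sx sy _ (_ , inn-s∈Proj) _ _ (_ , inn-sx≡ , inn-sy≡)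
  (τx , out-τx , _) (τy , out-τy , _) =
    ((τx , out-τx) , inProj-innˡ F {tx} {ty} z! τy inn-s∈Proj out-τy inn-sx≡)
  , ((τy , out-τy) , inProj-innʳ F {tx} {ty} z! τx inn-s∈Proj out-τx inn-sy≡)
  where
  z! : Unique (leaves (node tx ty))
  z! = Unique-≼ z≼T T!
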